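{- For every nonnegative integer $n$: let $LG_2(n)$ denote the number of partitions of $n$ into parts at least $2$ in which any two consecutive parts differ by at least $2$, and by at least $4$ if both are odd. Let $LG_{ -2}(n)$ denote the number of signed partitions of $n$ in which the positive parts are odd and each at least $2\ell^+$, and the negative parts are odd, distinct and each at most $2\ell^+$. Let $LG'_{ -2}(n)$ denote the number of signed partitions of $n$ in which the positive parts are at least $3$, odd and differ pairwise by at least $4$, and the negative parts are odd, distinct and each at most $2\ell^+-1$. Here $\ell^+$ is the number of positive parts of the signed partition. Then $LG_2(n)=LG_{ -2}(n)=LG'_{ -2}(n)$ for all $n\ge 0$.
   Context: A partition of an integer $n$ is a finite nonincreasing sequence of positive integers (its parts) summing to $n$. A signed partition of an integer $n$ is a pair $(\pi,\nu)$ of ordinary partitions with $|\pi|-|\nu|=n$, where $|\cdot|$ denotes the sum of parts; the parts of $\pi$ are the positive parts and the parts of $\nu$ are the negative parts (their sizes). $\ell^+$ denotes the number of positive parts of a signed partition. -}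

module Defs where

open import Data.Bool using (Bool; true; false; _∧_; _∨_; not; T)
open import Data.Nat using (ℕ; zero; suc; _+_; _*_; _∸_; _≤ᵇ_; _≡ᵇ_; _%_)
open import Data.List using (List; []; _∷_; length)
open import Data.Nat.ListAction using (sum)
open import Data.Product using (Σ; _×_)

-- Boolean predicates (so that membership proofs `T b` are unique and the
-- Σ-types below have exactly one element per combinatorial object).

odd : ℕ → Bool
odd x = x % 2 ≡ᵇ 1

allB : (ℕ → Bool) → List ℕ → Bool
allB p []       = true
allB p (x ∷ xs) = p x ∧ allB p xs

pairwiseB : (ℕ → ℕ → Bool) → List ℕ → Bool
pairwiseB r []       = true
pairwiseB r (x ∷ xs) = allB (r x) xs ∧ pairwiseB r xs

consecB : (ℕ → ℕ → Bool) → List ℕ → Bool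
consecB r []           = true
consecB r (x ∷ [])     = true
consecB r (x ∷ y ∷ xs) = r x y ∧ consecB r (y ∷ xs)

isPartition : List ℕ → Bool
isPartition xs = allB (λ x → 1 ≤ᵇ x) xs ∧ consecB (λ x y → y ≤ᵇ x) xs

isPartitionOf : ℕ → List ℕ → Bool
isPartitionOf n xs = isPartition xs ∧ (sum xs ≡ᵇ n)

isSignedPartitionOf : ℕ → List ℕ → List ℕ → Bool
isSignedPartitionOf n π ν = isPartition π ∧ isPartition ν ∧ (sum π ≡ᵇ n + sum ν)

ℓ⁺ : List ℕ → ℕ
ℓ⁺ π = length π

distinctB : List ℕ → Bool
distinctB = pairwiseB (λ x y → not (x ≡ᵇ y))

lg2Cond : ℕ → List ℕ → Bool
lg2Cond n xs =
  isPartitionOf n xs ∧ allB (λ x → 2 ≤ᵇ x) xs ∧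
  consecB (λ x y → (y + 2 ≤ᵇ x) ∧ (not (odd x ∧ odd y) ∨ (y + 4 ≤ᵇ x))) xs

LG2Set : ℕ → Set
LG2Set n = Σ (List ℕ) λ xs → T (lg2Cond n xs)

lgm2Cond : ℕ → List ℕ → List ℕ → Bool
lgm2Cond n π ν =
  isSignedPartitionOf n π ν ∧
  allB (λ x → odd x ∧ (2 * ℓ⁺ π ≤ᵇ x)) π ∧
  allB (λ y → odd y ∧ (y ≤ᵇ 2 * ℓ⁺ π)) ν ∧ distinctB ν

LGm2Set : ℕ → Set
LGm2Set n = Σ (List ℕ) λ π → Σ (List ℕ) λ ν → T (lgm2Cond n π ν)

lgm2'Cond : ℕ → List ℕ → List ℕ → Bool
lgm2'Cond n π ν =
  isSignedPartitionOf n π ν ∧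
  allB (λ x → odd x ∧ (3 ≤ᵇ x)) π ∧
  pairwiseB (λ x y → (y + 4 ≤ᵇ x) ∨ (x + 4 ≤ᵇ y)) π ∧
  allB (λ y → odd y ∧ (y + 1 ≤ᵇ 2 * ℓ⁺ π)) ν ∧ distinctB ν

LGm2'Set : ℕ → Set
LGm2'Set n = Σ (List ℕ) λ π → Σ (List ℕ) λ ν → T (lgm2'Cond n π ν)

-- Write each part x as bit (odd x) + 2 ⌊x/2⌋. The gap conditions of LG₂ say exactly that the half of a part
-- exceeds the half of the next part y by at least 1 + [y odd], and that the last half is at least 1. So each half is
-- bounded below by a floor determined by the parities of the later parts, and an LG₂ partition with ℓ parts is the
-- same as its parity word together with the nonincreasing list α of excesses over the floors; its weight is
-- 2 sum α plus the weight of the least partition with that parity word. Trading the parity word for the set ν of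
-- odd numbers 2 i + 1 at whose position i the parity is even, that least weight becomes ℓ (2 ℓ + 1) − sum ν.
-- In LG₋₂ and LG'₋₂ the positive parts are odd, with halves at least ℓ, resp. with halves at least 1 that drop by
-- at least 2; removing the constant floor ℓ, resp. the floors 1, 3, 5, …, again leaves an arbitrary nonincreasing
-- α, and the removed weight is ℓ (2 ℓ + 1) in both cases. So all three families of weight n correspond to the pairs
-- (α , ν) with 2 sum α + ℓ (2 ℓ + 1) = n + sum ν, and LG₂(n) is finite because its members are lists of length
-- and entries at most n.

module Submission where

open import Defs
open import Data.Nat using (ℕ)
open import Data.Fin using (Fin)
open import Data.Product using (Σ; _×_)
open import Function.Bundles using (_↔_)

open import Axiom.UniquenessOfIdentityProofs using (module Decidable⇒UIP)
open import Data.Bool using (Bool; true; false; _∧_; _∨_; not; T; if_then_else_)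
open import Data.Bool.Properties using (T-∧; T-∨; T-≡; T-irrelevant)
open import Data.Empty using (⊥-elim)
open import Data.Fin using (zero; suc)
open import Data.List
  using (List; []; _∷_; [_]; _++_; length; map; replicate; lookup; upTo; cartesianProductWith; filter; deduplicate)
import Data.List.Properties as List
open import Data.List.Membership.Propositional using (_∈_)
open import Data.List.Membership.Propositional.Properties
  using (∈-lookup; ∈-upTo⁺; ∈-cartesianProductWith⁺; ∈-filter⁺; ∈-filter⁻; ∈-deduplicate⁺; ∈-deduplicate⁻)
open import Data.List.Membership.Setoid.Properties using (unique⇒irrelevant)
open import Data.List.Relation.Unary.All as All using (All; []; _∷_)
import Data.List.Relation.Unary.All.Properties as All
open import Data.List.Relation.Unary.AllPairs as AllPairs using (AllPairs; []; _∷_)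
import Data.List.Relation.Unary.AllPairs.Properties as AllPairs
open import Data.List.Relation.Unary.Any using (here; there; index)
open import Data.List.Relation.Unary.Linked as Linked using (Linked; []; [-]; _∷_)
open import Data.List.Relation.Unary.Linked.Properties using (Linked⇒AllPairs; AllPairs⇒Linked)
import Data.List.Relation.Unary.Unique.DecPropositional.Properties as Unique
open import Data.Nat
  using (zero; suc; _+_; _*_; _∸_; _≤_; _<_; _≥_; _>_; _≤ᵇ_; _<ᵇ_; _≡ᵇ_; _%_; z≤n; s≤s; s≤s⁻¹; ⌊_/2⌋)
open import Data.Nat.DivMod using ([m+n]%n≡m%n; [m+kn]%n≡m%n)
open import Data.Nat.ListAction using (sum)
open import Data.Nat.Properties
open import Algebra.Properties.CommutativeSemigroup +-commutativeSemigroup using (x∙yz≈y∙xz)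
open import Data.Nat.Tactic.RingSolver using (solve-∀)
import Data.Product as Product
open import Data.Product using (_,_; proj₁; proj₂; ∃; uncurry)
open import Data.Sum as Sum using (_⊎_; inj₁; inj₂)
open import Data.Unit using (tt)
open import Function using (_∘_; const; flip)
open import Function.Bundles using (_⇔_; mk⇔; mk↔ₛ′; Equivalence)
open import Function.Construct.Composition using () renaming (equivalence to ⇔-trans)
open import Function.Construct.Identity using (⇔-id)
open import Function.Construct.Symmetry using (↔-sym)
open import Function.Properties.Inverse using (↔-trans)
open import Function.Related.TypeIsomorphisms using (Σ-assoc)
open import Relation.Binary.Definitions using (DecidableEquality)
open import Relation.Binary.PropositionalEquality
  using (_≡_; _≢_; ≢-sym; refl; sym; trans; cong; cong₂; subst; subst₂; setoid; module ≡-Reasoning)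
open import Relation.Nullary using (¬_)
open import Relation.Nullary.Decidable using (T?)

open Equivalence using (to; from)

private variable
  a b : Bool
  m n : ℕ

infixr 4 _∧-⇔_ _∨-⇔_

_∧-⇔_ : {X Y : Set} → T a ⇔ X → T b ⇔ Y → T (a ∧ b) ⇔ (X × Y)
a⇔X ∧-⇔ b⇔Y = ⇔-trans T-∧ (mk⇔ (λ (x , y) → to a⇔X x , to b⇔Y y) (λ (x , y) → from a⇔X x , from b⇔Y y))

_∨-⇔_ : {X Y : Set} → T a ⇔ X → T b ⇔ Y → T (a ∨ b) ⇔ (X ⊎ Y)
a⇔X ∨-⇔ b⇔Y = ⇔-trans T-∨ (mk⇔ (Sum.map (to a⇔X) (to b⇔Y)) (Sum.map (from a⇔X) (from b⇔Y)))

T-≤ᵇ : T (m ≤ᵇ n) ⇔ m ≤ n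
T-≤ᵇ = mk⇔ (≤ᵇ⇒≤ _ _) ≤⇒≤ᵇ

T-≡ᵇ : T (m ≡ᵇ n) ⇔ m ≡ n
T-≡ᵇ = mk⇔ (≡ᵇ⇒≡ _ _) (≡⇒≡ᵇ _ _)

T-not : T (not b) ⇔ (¬ T b)
T-not {true} = mk⇔ (λ ()) (λ ¬t → ¬t tt)
T-not {false} = mk⇔ (λ _ ()) (const tt)

T-≢ᵇ : T (not (m ≡ᵇ n)) ⇔ (m ≢ n)
T-≢ᵇ = ⇔-trans T-not (mk⇔ (λ ¬t → ¬t ∘ from T-≡ᵇ) (λ m≢n → m≢n ∘ to T-≡ᵇ))

module _ {p : ℕ → Bool} {P : ℕ → Set} (p⇔P : ∀ {x} → T (p x) ⇔ P x) where

  T-allB : ∀ {xs} → T (allB p xs) ⇔ All P xs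
  T-allB {[]} = mk⇔ (const []) (const tt)
  T-allB {x ∷ xs} = ⇔-trans (p⇔P ∧-⇔ T-allB) (mk⇔ (uncurry _∷_) All.uncons)

module _ {r : ℕ → ℕ → Bool} {R : ℕ → ℕ → Set} (r⇔R : ∀ {x y} → T (r x y) ⇔ R x y) where

  T-consecB : ∀ {xs} → T (consecB r xs) ⇔ Linked R xs
  T-consecB {[]} = mk⇔ (const []) (const tt)
  T-consecB {x ∷ []} = mk⇔ (const [-]) (const tt)
  T-consecB {x ∷ y ∷ xs} = ⇔-trans (r⇔R ∧-⇔ T-consecB) (mk⇔ (uncurry _∷_) λ { (rxy ∷ rs) → rxy , rs })

  T-pairwiseB : ∀ {xs} → T (pairwiseB r xs) ⇔ AllPairs R xs
  T-pairwiseB {[]} = mk⇔ (const []) (const tt)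
  T-pairwiseB {x ∷ xs} = ⇔-trans (T-allB r⇔R ∧-⇔ T-pairwiseB) (mk⇔ (uncurry _∷_) λ { (rx ∷ rs) → rx , rs })

Linked-map-All : ∀ {A : Set} {P : A → Set} {R S : A → A → Set} → (∀ {x y} → P x → P y → R x y → S x y) →
                 ∀ {xs} → All P xs → Linked R xs → Linked S xs
Linked-map-All f _ [] = []
Linked-map-All f _ [-] = [-]
Linked-map-All f (px ∷ pxs@(py ∷ _)) (rxy ∷ rs) = f px py rxy ∷ Linked-map-All f pxs rs

module _ {A B : Set} {p : A → Bool} {q : B → Bool} {P : A → Set} {Q : B → Set}
         (p⇔P : ∀ x → T (p x) ⇔ P x) (q⇔Q : ∀ y → T (q y) ⇔ Q y) where

  ΣT-↔ : (f : A → B) (g : B → A) →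
         (∀ x → P x → Q (f x)) → (∀ y → Q y → P (g y)) →
         (∀ x → P x → g (f x) ≡ x) → (∀ y → Q y → f (g y) ≡ y) →
         Σ A (T ∘ p) ↔ Σ B (T ∘ q)
  ΣT-↔ f g f-ok g-ok g∘f f∘g = mk↔ₛ′
    (λ (x , t) → f x , from (q⇔Q (f x)) (f-ok x (to (p⇔P x) t)))
    (λ (y , t) → g y , from (p⇔P (g y)) (g-ok y (to (q⇔Q y) t)))
    (λ (y , t) → ΣT-≡ (f∘g y (to (q⇔Q y) t)))
    (λ (x , t) → ΣT-≡ (g∘f x (to (p⇔P x) t)))
    where
    ΣT-≡ : ∀ {C : Set} {c : C → Bool} {z z′ : C} {t : T (c z)} {t′ : T (c z′)} →
           z ≡ z′ → _≡_ {A = Σ C (T ∘ c)} (z , t) (z′ , t′)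
    ΣT-≡ refl = cong (_ ,_) (T-irrelevant _ _)

∈↔Fin-length : {A : Set} (xs : List A) → (∃ λ x → x ∈ xs) ↔ Fin (length xs)
∈↔Fin-length xs = mk↔ₛ′ (index ∘ proj₂) (λ i → lookup xs i , ∈-lookup i) (index-∈-lookup xs) (lookup-index xs)
  where
  index-∈-lookup : ∀ xs i → index (∈-lookup {xs = xs} i) ≡ i
  index-∈-lookup (x ∷ xs) zero = refl
  index-∈-lookup (x ∷ xs) (suc i) = cong suc (index-∈-lookup xs i)
  lookup-index : ∀ xs (x∈ : ∃ λ x → x ∈ xs) → (lookup xs (index (proj₂ x∈)) , ∈-lookup (index (proj₂ x∈))) ≡ x∈
  lookup-index (x ∷ xs) (.x , here refl) = refl
  lookup-index (x ∷ xs) (y , there y∈) = cong (λ (z , z∈) → z , there z∈) (lookup-index xs (y , y∈))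

ΣT-finite : {A : Set} → DecidableEquality A → (p : A → Bool) (xs : List A) → (∀ {x} → T (p x) → x ∈ xs) →
            ∃ λ k → Σ A (T ∘ p) ↔ Fin k
ΣT-finite {A} _≟_ p xs complete = length ys , ↔-trans Σp↔∈ys (∈↔Fin-length ys)
  where
  ys : List A
  ys = deduplicate _≟_ (filter (T? ∘ p) xs)
  ∈ys-irrelevant : ∀ {x} (i j : x ∈ ys) → i ≡ j
  ∈ys-irrelevant = unique⇒irrelevant (setoid _) (Decidable⇒UIP.≡-irrelevant _≟_) (Unique.deduplicate-! _≟_ _)
  Σp↔∈ys : Σ A (T ∘ p) ↔ (∃ λ x → x ∈ ys)
  Σp↔∈ys = mk↔ₛ′
    (λ (x , t) → x , ∈-deduplicate⁺ _≟_ (∈-filter⁺ (T? ∘ p) {xs = xs} (complete t) t))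
    (λ (x , x∈) → x , proj₂ (∈-filter⁻ (T? ∘ p) {xs = xs} (∈-deduplicate⁻ _≟_ _ x∈)))
    (λ (x , x∈) → cong (x ,_) (∈ys-irrelevant _ _))
    (λ (x , t) → cong (x ,_) (T-irrelevant _ _))

Partition : List ℕ → Set
Partition xs = All (1 ≤_) xs × Linked _≥_ xs

T-isPartition : ∀ {xs} → T (isPartition xs) ⇔ Partition xs
T-isPartition = T-allB T-≤ᵇ ∧-⇔ T-consecB T-≤ᵇ

boundedLists : ℕ → ℕ → List (List ℕ)
boundedLists zero m = [ [] ]
boundedLists (suc l) m = [] ∷ cartesianProductWith _∷_ (upTo (suc m)) (boundedLists l m)

∈-boundedLists : ∀ {l m xs} → length xs ≤ l → All (_≤ m) xs → xs ∈ boundedLists l m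
∈-boundedLists {zero} {xs = []} _ _ = here refl
∈-boundedLists {suc l} {xs = []} _ _ = here refl
∈-boundedLists {suc l} {xs = x ∷ xs} (s≤s len≤l) (x≤m ∷ xs≤m) =
  there (∈-cartesianProductWith⁺ _∷_ (∈-upTo⁺ (s≤s x≤m)) (∈-boundedLists len≤l xs≤m))

length≤sum : ∀ {xs} → All (1 ≤_) xs → length xs ≤ sum xs
length≤sum [] = z≤n
length≤sum (1≤x ∷ 1≤xs) = +-mono-≤ 1≤x (length≤sum 1≤xs)

parts≤sum : ∀ xs → All (_≤ sum xs) xs
parts≤sum [] = []
parts≤sum (x ∷ xs) = m≤m+n x (sum xs) ∷ All.map (λ y≤ → ≤-trans y≤ (m≤n+m _ x)) (parts≤sum xs)

partition∈boundedLists : ∀ {n xs} → T (isPartitionOf n xs) → xs ∈ boundedLists n n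
partition∈boundedLists {n} {xs} t with (1≤xs , _) , refl ← to (T-isPartition {xs} ∧-⇔ T-≡ᵇ {sum xs} {n}) t =
  ∈-boundedLists (length≤sum 1≤xs) (parts≤sum xs)

-- Parity and halves

bit : Bool → ℕ
bit false = 0
bit true = 1

odd-2+ : ∀ x → odd (2 + x) ≡ odd x
odd-2+ x = cong (_≡ᵇ 1) (trans (cong (_% 2) (+-comm 2 x)) ([m+n]%n≡m%n x 2))

odd-bit+2* : ∀ b h → odd (bit b + 2 * h) ≡ b
odd-bit+2* b h = begin
  (bit b + 2 * h) % 2 ≡ᵇ 1 ≡⟨ cong (λ z → (bit b + z) % 2 ≡ᵇ 1) (*-comm 2 h) ⟩
  (bit b + h * 2) % 2 ≡ᵇ 1 ≡⟨ cong (_≡ᵇ 1) ([m+kn]%n≡m%n (bit b) h 2) ⟩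
  bit b % 2 ≡ᵇ 1           ≡⟨ bit%2 b ⟩
  b                        ∎
  where
  open ≡-Reasoning
  bit%2 : ∀ b → (bit b % 2 ≡ᵇ 1) ≡ b
  bit%2 false = refl
  bit%2 true = refl

bit+2*suc : ∀ b h → bit b + 2 * suc h ≡ 2 + (bit b + 2 * h)
bit+2*suc b h = t+2*suc (bit b) h
  where
  t+2*suc : ∀ t h → t + 2 * suc h ≡ 2 + (t + 2 * h)
  t+2*suc = solve-∀

⌊bit+2*/2⌋ : ∀ b h → ⌊ bit b + 2 * h /2⌋ ≡ h
⌊bit+2*/2⌋ false zero = refl
⌊bit+2*/2⌋ true zero = refl
⌊bit+2*/2⌋ b (suc h) = trans (cong ⌊_/2⌋ (bit+2*suc b h)) (cong suc (⌊bit+2*/2⌋ b h))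

bit-odd+2*⌊/2⌋ : ∀ x → bit (odd x) + 2 * ⌊ x /2⌋ ≡ x
bit-odd+2*⌊/2⌋ zero = refl
bit-odd+2*⌊/2⌋ (suc zero) = refl
bit-odd+2*⌊/2⌋ (suc (suc x)) = begin
  bit (odd (2 + x)) + 2 * suc ⌊ x /2⌋ ≡⟨ cong (λ b → bit b + 2 * suc ⌊ x /2⌋) (odd-2+ x) ⟩
  bit (odd x) + 2 * suc ⌊ x /2⌋       ≡⟨ bit+2*suc (odd x) ⌊ x /2⌋ ⟩
  2 + (bit (odd x) + 2 * ⌊ x /2⌋)     ≡⟨ cong (2 +_) (bit-odd+2*⌊/2⌋ x) ⟩
  2 + x                               ∎
  where open ≡-Reasoning

odd⇒1≤ : ∀ {x} → T (odd x) → 1 ≤ x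
odd⇒1≤ {suc x} _ = s≤s z≤n

bit+2*-≤ : ∀ b′ a b c → (bit b′ + 2 * a ≤ bit b + 2 * c) ⇔ (bit (b′ ∧ not b) + a ≤ c)
bit+2*-≤ false a false c = mk⇔ (*-cancelˡ-≤ 2) (*-monoʳ-≤ 2)
bit+2*-≤ false a true c =
  mk⇔ (λ 2a≤1+2c → s≤s⁻¹ (*-cancelˡ-< 2 a (suc c) (subst (2 * a <_) (sym (*-suc 2 c)) (s≤s 2a≤1+2c))))
      (m≤n⇒m≤1+n ∘ *-monoʳ-≤ 2)
bit+2*-≤ true a false c =
  mk⇔ (*-cancelˡ-< 2 a c)
      (λ a<c → ≤-trans (n≤1+n _) (subst (_≤ 2 * c) (*-suc 2 a) (*-monoʳ-≤ 2 a<c)))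
bit+2*-≤ true a true c = mk⇔ (*-cancelˡ-≤ 2 ∘ s≤s⁻¹) (s≤s ∘ *-monoʳ-≤ 2)

≤⇔⌊/2⌋ : ∀ y k x → (y + 2 * k ≤ x) ⇔ (bit (odd y ∧ not (odd x)) + (k + ⌊ y /2⌋) ≤ ⌊ x /2⌋)
≤⇔⌊/2⌋ y k x =
  subst₂ (λ y′ x′ → (y′ + 2 * k ≤ x′) ⇔ (bit (odd y ∧ not (odd x)) + (k + ⌊ y /2⌋) ≤ ⌊ x /2⌋))
    (bit-odd+2*⌊/2⌋ y) (bit-odd+2*⌊/2⌋ x)
    (subst (λ z → (z ≤ bit (odd x) + 2 * ⌊ x /2⌋) ⇔ (bit (odd y ∧ not (odd x)) + (k + ⌊ y /2⌋) ≤ ⌊ x /2⌋))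
      (shift (bit (odd y)) ⌊ y /2⌋ k)
      (bit+2*-≤ (odd y) (k + ⌊ y /2⌋) (odd x) ⌊ x /2⌋))
  where
  shift : ∀ t h k → t + 2 * (k + h) ≡ t + 2 * h + 2 * k
  shift = solve-∀

odd-≤⇔ : ∀ y k x → T (odd y) → T (odd x) → (y + 2 * k ≤ x) ⇔ (k + ⌊ y /2⌋ ≤ ⌊ x /2⌋)
odd-≤⇔ y k x oy ox with odd y | odd x | ≤⇔⌊/2⌋ y k x
... | true | true | y≤x⇔ = y≤x⇔

-- Staircases

-- The least possible half of a part of a staircase is the floor of the parities of the later parts.
module Staircase (c : ℕ) (δ : Bool → ℕ) where

  floor : List Bool → ℕ
  floor [] = c
  floor (b ∷ bs) = δ b + floor bs

  Gap : ℕ → ℕ → Set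
  Gap x y = δ (odd y) + ⌊ y /2⌋ ≤ ⌊ x /2⌋

  Stair : List ℕ → Set
  Stair xs = Linked Gap xs × All (λ x → c ≤ ⌊ x /2⌋) xs

  raise : List ℕ → List Bool → List ℕ
  raise (a ∷ α) (b ∷ bs) = bit b + 2 * (a + floor bs) ∷ raise α bs
  raise _ _ = []

  lower : List ℕ → List ℕ
  lower [] = []
  lower (x ∷ xs) = ⌊ x /2⌋ ∸ floor (map odd xs) ∷ lower xs

  base : List Bool → ℕ
  base [] = 0
  base (b ∷ bs) = bit b + 2 * floor bs + base bs

  c≤floor : ∀ bs → c ≤ floor bs
  c≤floor [] = ≤-refl
  c≤floor (b ∷ bs) = ≤-trans (c≤floor bs) (m≤n+m _ (δ b))

  Stair-tail : ∀ {x xs} → Stair (x ∷ xs) → Stair xs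
  Stair-tail (gaps , c≤xs) = Linked.tail gaps , All.tail c≤xs

  length-lower : ∀ xs → length (lower xs) ≡ length xs
  length-lower [] = refl
  length-lower (x ∷ xs) = cong suc (length-lower xs)

  length-raise : ∀ α bs → length α ≡ length bs → length (raise α bs) ≡ length α
  length-raise [] [] _ = refl
  length-raise (a ∷ α) (b ∷ bs) eq = cong suc (length-raise α bs (suc-injective eq))

  odd-raise : ∀ α bs → length α ≡ length bs → map odd (raise α bs) ≡ bs
  odd-raise [] [] _ = refl
  odd-raise (a ∷ α) (b ∷ bs) eq = cong₂ _∷_ (odd-bit+2* b (a + floor bs)) (odd-raise α bs (suc-injective eq))

  lower-raise : ∀ α bs → length α ≡ length bs → lower (raise α bs) ≡ α
  lower-raise [] [] _ = refl
  lower-raise (a ∷ α) (b ∷ bs) eq = cong₂ _∷_ head-eq (lower-raise α bs (suc-injective eq))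
    where
    open ≡-Reasoning
    head-eq : ⌊ bit b + 2 * (a + floor bs) /2⌋ ∸ floor (map odd (raise α bs)) ≡ a
    head-eq = begin
      ⌊ bit b + 2 * (a + floor bs) /2⌋ ∸ floor (map odd (raise α bs))
        ≡⟨ cong₂ _∸_ (⌊bit+2*/2⌋ b (a + floor bs)) (cong floor (odd-raise α bs (suc-injective eq))) ⟩
      a + floor bs ∸ floor bs
        ≡⟨ m+n∸n≡m a (floor bs) ⟩
      a ∎

  floor≤⌊/2⌋ : ∀ x xs → Stair (x ∷ xs) → floor (map odd xs) ≤ ⌊ x /2⌋
  floor≤⌊/2⌋ x [] (_ , c≤x ∷ _) = c≤x
  floor≤⌊/2⌋ x (y ∷ ys) s@(gap ∷ _ , _) =
    ≤-trans (+-monoʳ-≤ (δ (odd y)) (floor≤⌊/2⌋ y ys (Stair-tail s))) gap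

  raise-lower : ∀ xs → Stair xs → raise (lower xs) (map odd xs) ≡ xs
  raise-lower [] _ = refl
  raise-lower (x ∷ xs) s = cong₂ _∷_ head-eq (raise-lower xs (Stair-tail s))
    where
    open ≡-Reasoning
    head-eq : bit (odd x) + 2 * (⌊ x /2⌋ ∸ floor (map odd xs) + floor (map odd xs)) ≡ x
    head-eq = begin
      bit (odd x) + 2 * (⌊ x /2⌋ ∸ floor (map odd xs) + floor (map odd xs))
        ≡⟨ cong (λ h → bit (odd x) + 2 * h) (m∸n+n≡m (floor≤⌊/2⌋ x xs s)) ⟩
      bit (odd x) + 2 * ⌊ x /2⌋
        ≡⟨ bit-odd+2*⌊/2⌋ x ⟩
      x ∎

  lower-nonInc : ∀ xs → Stair xs → Linked _≥_ (lower xs)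
  lower-nonInc [] _ = []
  lower-nonInc (x ∷ []) _ = [-]
  lower-nonInc (x ∷ y ∷ ys) s@(gap ∷ _ , _) = step ∷ lower-nonInc (y ∷ ys) (Stair-tail s)
    where
    F : ℕ
    F = floor (map odd ys)
    step : ⌊ y /2⌋ ∸ F ≤ ⌊ x /2⌋ ∸ (δ (odd y) + F)
    step = subst (_≤ ⌊ x /2⌋ ∸ (δ (odd y) + F)) ([m+n]∸[m+o]≡n∸o (δ (odd y)) ⌊ y /2⌋ F)
                 (∸-monoˡ-≤ (δ (odd y) + F) gap)

  raise-stair : ∀ α bs → Linked _≥_ α → Stair (raise α bs)
  raise-stair α bs α≥ = gaps α bs α≥ , floors α bs
    where
    gaps : ∀ α bs → Linked _≥_ α → Linked Gap (raise α bs)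
    gaps [] _ _ = []
    gaps (a ∷ α) [] _ = []
    gaps (a ∷ []) (b ∷ bs) _ = [-]
    gaps (a ∷ a′ ∷ α) (b ∷ []) _ = [-]
    gaps (a ∷ a′ ∷ α) (b ∷ b′ ∷ bs) (a′≤a ∷ α≥) = gap ∷ gaps (a′ ∷ α) (b′ ∷ bs) α≥
      where
      open ≤-Reasoning
      F : ℕ
      F = floor bs
      gap : Gap (bit b + 2 * (a + (δ b′ + F))) (bit b′ + 2 * (a′ + F))
      gap = begin
        δ (odd (bit b′ + 2 * (a′ + F))) + ⌊ bit b′ + 2 * (a′ + F) /2⌋
          ≡⟨ cong₂ _+_ (cong δ (odd-bit+2* b′ (a′ + F))) (⌊bit+2*/2⌋ b′ (a′ + F)) ⟩
        δ b′ + (a′ + F)   ≡⟨ x∙yz≈y∙xz (δ b′) a′ F ⟩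
        a′ + (δ b′ + F)   ≤⟨ +-monoˡ-≤ _ a′≤a ⟩
        a + (δ b′ + F)    ≡⟨ sym (⌊bit+2*/2⌋ b (a + (δ b′ + F))) ⟩
        ⌊ bit b + 2 * (a + (δ b′ + F)) /2⌋ ∎
    floors : ∀ α bs → All (λ x → c ≤ ⌊ x /2⌋) (raise α bs)
    floors [] _ = []
    floors (a ∷ α) [] = []
    floors (a ∷ α) (b ∷ bs) =
      subst (c ≤_) (sym (⌊bit+2*/2⌋ b (a + floor bs))) (≤-trans (c≤floor bs) (m≤n+m _ a)) ∷ floors α bs

  sum-raise : ∀ α bs → length α ≡ length bs → sum (raise α bs) ≡ 2 * sum α + base bs
  sum-raise [] [] _ = refl
  sum-raise (a ∷ α) (b ∷ bs) eq =
    trans (cong (bit b + 2 * (a + floor bs) +_) (sum-raise α bs (suc-injective eq)))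
          (rearrange (bit b) a (floor bs) (sum α) (base bs))
    where
    rearrange : ∀ t a f s B → t + 2 * (a + f) + (2 * s + B) ≡ 2 * (a + s) + (t + 2 * f + B)
    rearrange = solve-∀

module LG2Staircase = Staircase 1 (λ b → 1 + bit b)

-- S₂ and S₄ stand for y + 2 ≤ x and y + 4 ≤ x, where x = bit bx + 2 hx and y = bit by + 2 hy.
gap-by-parity : ∀ bx by {hx hy} {S₂ S₄ : Set} →
  S₂ ⇔ (bit (by ∧ not bx) + (1 + hy) ≤ hx) → S₄ ⇔ (bit (by ∧ not bx) + (2 + hy) ≤ hx) →
  (S₂ × (T (not (bx ∧ by)) ⊎ S₄)) ⇔ (1 + bit by + hy ≤ hx)
gap-by-parity true true S₂⇔ S₄⇔ =
  mk⇔ (λ { (_ , inj₂ s₄) → to S₄⇔ s₄ }) (λ gap → from S₂⇔ (<⇒≤ gap) , inj₂ (from S₄⇔ gap))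
gap-by-parity true false S₂⇔ _ = mk⇔ (to S₂⇔ ∘ proj₁) (λ gap → from S₂⇔ gap , inj₁ tt)
gap-by-parity false true S₂⇔ _ = mk⇔ (to S₂⇔ ∘ proj₁) (λ gap → from S₂⇔ gap , inj₁ tt)
gap-by-parity false false S₂⇔ _ = mk⇔ (to S₂⇔ ∘ proj₁) (λ gap → from S₂⇔ gap , inj₁ tt)

lg2-gap⇔ : ∀ {x y} → T ((y + 2 ≤ᵇ x) ∧ (not (odd x ∧ odd y) ∨ (y + 4 ≤ᵇ x))) ⇔ LG2Staircase.Gap x y
lg2-gap⇔ {x} {y} =
  ⇔-trans (T-≤ᵇ ∧-⇔ ⇔-id _ ∨-⇔ T-≤ᵇ) (gap-by-parity (odd x) (odd y) (≤⇔⌊/2⌋ y 1 x) (≤⇔⌊/2⌋ y 2 x))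

IsLG2 : ℕ → List ℕ → Set
IsLG2 n xs = LG2Staircase.Stair xs × sum xs ≡ n

lg2Cond⇔ : ∀ n xs → T (lg2Cond n xs) ⇔ IsLG2 n xs
lg2Cond⇔ n xs =
  ⇔-trans ((T-isPartition ∧-⇔ T-≡ᵇ) ∧-⇔ T-allB (λ {x} → ⇔-trans T-≤ᵇ (≤⇔⌊/2⌋ 0 1 x)) ∧-⇔
           T-consecB (λ {x} {y} → lg2-gap⇔ {x} {y}))
          (mk⇔ (λ ((_ , Σ≡n) , 1≤xs , gaps) → (gaps , 1≤xs) , Σ≡n)
               (λ ((gaps , 1≤xs) , Σ≡n) →
                 ((All.map 1≤⌊/2⌋⇒1≤ 1≤xs , Linked.map gap⇒≥ gaps) , Σ≡n) , 1≤xs , gaps))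
  where
  1≤⌊/2⌋⇒1≤ : ∀ {x} → 1 ≤ ⌊ x /2⌋ → 1 ≤ x
  1≤⌊/2⌋⇒1≤ {x} 1≤ = ≤-trans 1≤ (⌊n/2⌋≤n x)
  gap⇒≥ : ∀ {x y} → LG2Staircase.Gap x y → y ≤ x
  gap⇒≥ gap = ≮⇒≥ (λ x<y → <⇒≱ (≤-trans (s≤s (m≤n+m _ _)) gap) (⌊n/2⌋-mono (<⇒≤ x<y)))

bitCodeCond : ℕ → List ℕ × List Bool → Bool
bitCodeCond n (α , bs) =
  consecB (λ a a′ → a′ ≤ᵇ a) α ∧ (length α ≡ᵇ length bs) ∧ (2 * sum α + LG2Staircase.base bs ≡ᵇ n)

BitCode : ℕ → List ℕ × List Bool → Set
BitCode n (α , bs) = Linked _≥_ α × length α ≡ length bs × 2 * sum α + LG2Staircase.base bs ≡ n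

T-bitCodeCond : ∀ n αbs → T (bitCodeCond n αbs) ⇔ BitCode n αbs
T-bitCodeCond n (α , bs) = T-consecB T-≤ᵇ ∧-⇔ T-≡ᵇ ∧-⇔ T-≡ᵇ

lg2↔bitCode : ∀ n → LG2Set n ↔ Σ (List ℕ × List Bool) (T ∘ bitCodeCond n)
lg2↔bitCode n = ΣT-↔ (lg2Cond⇔ n) (T-bitCodeCond n)
  (λ xs → lower xs , map odd xs) (uncurry raise) code-ok lg2-ok raise∘code code∘raise
  where
  open LG2Staircase
  code-ok : ∀ xs → IsLG2 n xs → BitCode n (lower xs , map odd xs)
  code-ok xs (st , Σ≡n) = lower-nonInc xs st , len , (begin
      2 * sum (lower xs) + base (map odd xs) ≡⟨ sym (sum-raise (lower xs) (map odd xs) len) ⟩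
      sum (raise (lower xs) (map odd xs))    ≡⟨ cong sum (raise-lower xs st) ⟩
      sum xs                                 ≡⟨ Σ≡n ⟩
      n                                      ∎)
    where
    open ≡-Reasoning
    len : length (lower xs) ≡ length (map odd xs)
    len = trans (length-lower xs) (sym (List.length-map odd xs))
  lg2-ok : ∀ αbs → BitCode n αbs → IsLG2 n (uncurry raise αbs)
  lg2-ok (α , bs) (α≥ , len , w) = raise-stair α bs α≥ , trans (sum-raise α bs len) w
  raise∘code : ∀ xs → IsLG2 n xs → raise (lower xs) (map odd xs) ≡ xs
  raise∘code xs (st , _) = raise-lower xs st
  code∘raise : ∀ αbs → BitCode n αbs → (lower (uncurry raise αbs) , map odd (uncurry raise αbs)) ≡ αbs
  code∘raise (α , bs) (_ , len , _) = cong₂ _,_ (lower-raise α bs len) (odd-raise α bs len)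

-- Negative parts

OddSubset : ℕ → List ℕ → Set
OddSubset ℓ ν = AllPairs _>_ ν × All (λ y → T (odd y) × y < 2 * ℓ) ν

oddSubset⇔ : ∀ {ℓ ν} → (Partition ν × All (λ y → T (odd y) × y < 2 * ℓ) ν × AllPairs _≢_ ν) ⇔ OddSubset ℓ ν
oddSubset⇔ = mk⇔
  (λ ((_ , ν≥) , odd< , ν≢) →
    AllPairs.zipWith (λ (z≤y , y≢z) → ≤∧≢⇒< z≤y (≢-sym y≢z)) (Linked⇒AllPairs (flip ≤-trans) ν≥ , ν≢) , odd<)
  (λ (ν> , odd<) →
    (All.map (odd⇒1≤ ∘ proj₁) odd< , AllPairs⇒Linked (AllPairs.map <⇒≤ ν>)) , odd< , AllPairs.map >⇒≢ ν>)

T-odd∧≤ᵇ2* : ∀ {ℓ y} → T (odd y ∧ (y ≤ᵇ 2 * ℓ)) ⇔ (T (odd y) × y < 2 * ℓ)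
T-odd∧≤ᵇ2* {ℓ} {y} = ⇔-trans (⇔-id _ ∧-⇔ T-≤ᵇ) (mk⇔ (λ (oy , y≤) → oy , ≤∧≢⇒< y≤ (odd≢2* oy)) (Product.map₂ <⇒≤))
  where
  odd≢2* : T (odd y) → y ≢ 2 * ℓ
  odd≢2* oy y≡2ℓ = subst T (odd-bit+2* false ℓ) (subst (T ∘ odd) y≡2ℓ oy)

T-odd∧+1≤ᵇ2* : ∀ {ℓ y} → T (odd y ∧ (y + 1 ≤ᵇ 2 * ℓ)) ⇔ (T (odd y) × y < 2 * ℓ)
T-odd∧+1≤ᵇ2* {ℓ} {y} = ⇔-id _ ∧-⇔ ⇔-trans T-≤ᵇ (subst (λ m → (m ≤ 2 * ℓ) ⇔ (y < 2 * ℓ)) (+-comm 1 y) (⇔-id _))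

2+<2*suc⇔ : ∀ {y ℓ} → (2 + y < 2 * suc ℓ) ⇔ (y < 2 * ℓ)
2+<2*suc⇔ {y} {ℓ} =
  subst (λ m → (2 + y < m) ⇔ (y < 2 * ℓ)) (sym (*-suc 2 ℓ)) (mk⇔ (s≤s⁻¹ ∘ s≤s⁻¹) (s≤s ∘ s≤s))

-- Bit i of bs (counted from the head) is false exactly when 2 i + 1 is a part of negParts bs.
lift : Bool → List ℕ → List ℕ
lift b ρ = map (2 +_) ρ ++ (if b then [] else [ 1 ])

negParts : List Bool → List ℕ
negParts [] = []
negParts (b ∷ bs) = lift b (negParts bs)

peel : List ℕ → Bool × List ℕ
peel [] = true , []
peel (suc (suc y) ∷ ν) = Product.map₂ (y ∷_) (peel ν)
peel (_ ∷ _) = false , []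

bitsOf : ℕ → List ℕ → List Bool
bitsOf zero ν = []
bitsOf (suc ℓ) ν = proj₁ (peel ν) ∷ bitsOf ℓ (proj₂ (peel ν))

length-bitsOf : ∀ ℓ ν → length (bitsOf ℓ ν) ≡ ℓ
length-bitsOf zero ν = refl
length-bitsOf (suc ℓ) ν = cong suc (length-bitsOf ℓ (proj₂ (peel ν)))

peel-lift : ∀ b ρ → peel (lift b ρ) ≡ (b , ρ)
peel-lift true [] = refl
peel-lift false [] = refl
peel-lift b (y ∷ ρ) = cong (Product.map₂ (y ∷_)) (peel-lift b ρ)

bitsOf-negParts : ∀ bs → bitsOf (length bs) (negParts bs) ≡ bs
bitsOf-negParts [] = refl
bitsOf-negParts (b ∷ bs) rewrite peel-lift b (negParts bs) = cong (b ∷_) (bitsOf-negParts bs)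

lift-oddSubset : ∀ {ℓ ρ} b → OddSubset ℓ ρ → OddSubset (suc ℓ) (lift b ρ)
lift-oddSubset {ℓ} {ρ} b (ρ> , ρ-odd<) =
  AllPairs.++⁺ (AllPairs.map⁺ (AllPairs.map (s≤s ∘ s≤s) ρ>)) (last-pairs b)
               (All.map⁺ (All.map (λ _ → above-last b) ρ-odd<)) ,
  All.++⁺ (All.map⁺ (All.map (λ {y} (oy , y<) → subst T (sym (odd-2+ y)) oy , from 2+<2*suc⇔ y<) ρ-odd<)) (last-odd< b)
  where
  last-pairs : ∀ b → AllPairs _>_ (if b then [] else [ 1 ])
  last-pairs true = []
  last-pairs false = [] ∷ []
  above-last : ∀ {y} b → All (2 + y >_) (if b then [] else [ 1 ])
  above-last true = []
  above-last false = s≤s (s≤s z≤n) ∷ []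
  last-odd< : ∀ b → All (λ y → T (odd y) × y < 2 * suc ℓ) (if b then [] else [ 1 ])
  last-odd< true = []
  last-odd< false = (tt , subst (1 <_) (sym (*-suc 2 ℓ)) (s≤s (s≤s z≤n))) ∷ []

negParts-oddSubset : ∀ bs → OddSubset (length bs) (negParts bs)
negParts-oddSubset [] = [] , []
negParts-oddSubset (b ∷ bs) = lift-oddSubset b (negParts-oddSubset bs)

lift-peel : ∀ {ℓ} ν → OddSubset (suc ℓ) ν → uncurry lift (peel ν) ≡ ν
lift-peel [] _ = refl
lift-peel (0 ∷ _) (_ , (() , _) ∷ _)
lift-peel (1 ∷ []) _ = refl
lift-peel (1 ∷ 0 ∷ _) (_ , _ ∷ (() , _) ∷ _)
lift-peel (1 ∷ suc (suc _) ∷ _) ((s≤s () ∷ _) ∷ _ , _)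
lift-peel (suc (suc y) ∷ ν) (_ ∷ ν> , _ ∷ ν-odd<) = cong (2 + y ∷_) (lift-peel ν (ν> , ν-odd<))

peel-oddSubset : ∀ {ℓ} ν → OddSubset (suc ℓ) ν → OddSubset ℓ (proj₂ (peel ν))
peel-oddSubset [] _ = [] , []
peel-oddSubset (0 ∷ _) (_ , (() , _) ∷ _)
peel-oddSubset (1 ∷ _) _ = [] , []
peel-oddSubset {ℓ} (suc (suc y) ∷ ν) (y>ν ∷ ν> , (oy , y<) ∷ ν-odd<) =
  below ∷ proj₁ ρ-sub , (subst T (odd-2+ y) oy , to 2+<2*suc⇔ y<) ∷ proj₂ ρ-sub
  where
  ρ-sub : OddSubset ℓ (proj₂ (peel ν))
  ρ-sub = peel-oddSubset ν (ν> , ν-odd<)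
  below : All (y >_) (proj₂ (peel ν))
  below = All.map (s≤s⁻¹ ∘ s≤s⁻¹)
    (All.map⁻ (All.++⁻ˡ _ (subst (All (2 + y >_)) (sym (lift-peel ν (ν> , ν-odd<))) y>ν)))

negParts-bitsOf : ∀ ℓ ν → OddSubset ℓ ν → negParts (bitsOf ℓ ν) ≡ ν
negParts-bitsOf zero [] _ = refl
negParts-bitsOf zero (_ ∷ _) (_ , (_ , ()) ∷ _)
negParts-bitsOf (suc ℓ) ν sub =
  trans (cong (lift (proj₁ (peel ν))) (negParts-bitsOf ℓ (proj₂ (peel ν)) (peel-oddSubset ν sub))) (lift-peel ν sub)

length-lift : ∀ b ρ → length (lift b ρ) ≡ bit (not b) + length ρ
length-lift true [] = refl
length-lift false [] = refl
length-lift b (y ∷ ρ) = trans (cong suc (length-lift b ρ)) (sym (+-suc (bit (not b)) (length ρ)))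

sum-lift : ∀ b ρ → sum (lift b ρ) ≡ bit (not b) + (2 * length ρ + sum ρ)
sum-lift true [] = refl
sum-lift false [] = refl
sum-lift b (y ∷ ρ) = trans (cong (2 + y +_) (sum-lift b ρ)) (rearrange (bit (not b)) y (length ρ) (sum ρ))
  where
  rearrange : ∀ t y l s → 2 + y + (t + (2 * l + s)) ≡ t + (2 * suc l + (y + s))
  rearrange = solve-∀

bit+bit-not : ∀ b → bit b + bit (not b) ≡ 1
bit+bit-not true = refl
bit+bit-not false = refl

floor+length-negParts : ∀ bs → LG2Staircase.floor bs + length (negParts bs) ≡ 1 + 2 * length bs
floor+length-negParts [] = refl
floor+length-negParts (b ∷ bs) = begin
  1 + bit b + F + length (lift b (negParts bs))   ≡⟨ cong (1 + bit b + F +_) (length-lift b (negParts bs)) ⟩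
  1 + bit b + F + (bit (not b) + L)               ≡⟨ rearrange (bit b) (bit (not b)) F L ⟩
  1 + (bit b + bit (not b)) + (F + L)             ≡⟨ cong₂ (λ u v → 1 + u + v) (bit+bit-not b) (floor+length-negParts bs) ⟩
  1 + 1 + (1 + 2 * length bs)                     ≡⟨ 2+[1+2*l] (length bs) ⟩
  1 + 2 * suc (length bs)                         ∎
  where
  open ≡-Reasoning
  F L : ℕ
  F = LG2Staircase.floor bs
  L = length (negParts bs)
  rearrange : ∀ t u f l → 1 + t + f + (u + l) ≡ 1 + (t + u) + (f + l)
  rearrange = solve-∀
  2+[1+2*l] : ∀ l → 1 + 1 + (1 + 2 * l) ≡ 1 + 2 * suc l
  2+[1+2*l] = solve-∀

*-1+2*-suc : ∀ ℓ → 1 + 2 * (1 + 2 * ℓ) + ℓ * (1 + 2 * ℓ) ≡ suc ℓ * (1 + 2 * suc ℓ)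
*-1+2*-suc = solve-∀

base+sum-negParts : ∀ bs → LG2Staircase.base bs + sum (negParts bs) ≡ length bs * (1 + 2 * length bs)
base+sum-negParts [] = refl
base+sum-negParts (b ∷ bs) = begin
  bit b + 2 * F + B + sum (lift b (negParts bs))        ≡⟨ cong (bit b + 2 * F + B +_) (sum-lift b (negParts bs)) ⟩
  bit b + 2 * F + B + (bit (not b) + (2 * L + S))       ≡⟨ rearrange (bit b) (bit (not b)) F B L S ⟩
  (bit b + bit (not b)) + 2 * (F + L) + (B + S)
    ≡⟨ cong₂ (λ u v → u + 2 * v + (B + S)) (bit+bit-not b) (floor+length-negParts bs) ⟩
  1 + 2 * (1 + 2 * ℓ) + (B + S)                         ≡⟨ cong (1 + 2 * (1 + 2 * ℓ) +_) (base+sum-negParts bs) ⟩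
  1 + 2 * (1 + 2 * ℓ) + ℓ * (1 + 2 * ℓ)                 ≡⟨ *-1+2*-suc ℓ ⟩
  suc ℓ * (1 + 2 * suc ℓ)                               ∎
  where
  open ≡-Reasoning
  F B L S ℓ : ℕ
  F = LG2Staircase.floor bs
  B = LG2Staircase.base bs
  L = length (negParts bs)
  S = sum (negParts bs)
  ℓ = length bs
  rearrange : ∀ t u f B l s → t + 2 * f + B + (u + (2 * l + s)) ≡ (t + u) + 2 * (f + l) + (B + s)
  rearrange = solve-∀

codeCond : ℕ → List ℕ × List ℕ → Bool
codeCond n (α , ν) =
  consecB (λ a a′ → a′ ≤ᵇ a) α ∧
  (pairwiseB (λ y z → z <ᵇ y) ν ∧ allB (λ y → odd y ∧ (y <ᵇ 2 * length α)) ν) ∧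
  (2 * sum α + length α * (1 + 2 * length α) ≡ᵇ n + sum ν)

Code : ℕ → List ℕ × List ℕ → Set
Code n (α , ν) = Linked _≥_ α × OddSubset (length α) ν × 2 * sum α + length α * (1 + 2 * length α) ≡ n + sum ν

T-codeCond : ∀ n αν → T (codeCond n αν) ⇔ Code n αν
T-codeCond n (α , ν) = T-consecB T-≤ᵇ ∧-⇔ (T-pairwiseB T-≤ᵇ ∧-⇔ T-allB (⇔-id _ ∧-⇔ T-≤ᵇ)) ∧-⇔ T-≡ᵇ

CodeSet : ℕ → Set
CodeSet n = Σ (List ℕ × List ℕ) (T ∘ codeCond n)

bitCode↔code : ∀ n → Σ (List ℕ × List Bool) (T ∘ bitCodeCond n) ↔ CodeSet n
bitCode↔code n = ΣT-↔ (T-bitCodeCond n) (T-codeCond n)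
  (Product.map₂ negParts) (λ (α , ν) → α , bitsOf (length α) ν) code-ok bitCode-ok bits∘neg neg∘bits
  where
  open LG2Staircase using (base)
  code-ok : ∀ αbs → BitCode n αbs → Code n (Product.map₂ negParts αbs)
  code-ok (α , bs) (α≥ , len , w) =
    α≥ , subst (λ ℓ → OddSubset ℓ (negParts bs)) (sym len) (negParts-oddSubset bs) , (begin
      2 * sum α + length α * (1 + 2 * length α)  ≡⟨ cong (λ ℓ → 2 * sum α + ℓ * (1 + 2 * ℓ)) len ⟩
      2 * sum α + length bs * (1 + 2 * length bs) ≡⟨ cong (2 * sum α +_) (sym (base+sum-negParts bs)) ⟩
      2 * sum α + (base bs + sum (negParts bs))  ≡⟨ sym (+-assoc (2 * sum α) (base bs) _) ⟩
      2 * sum α + base bs + sum (negParts bs)    ≡⟨ cong (_+ sum (negParts bs)) w ⟩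
      n + sum (negParts bs)                      ∎)
    where open ≡-Reasoning
  bitCode-ok : ∀ αν → Code n αν → BitCode n (proj₁ αν , bitsOf (length (proj₁ αν)) (proj₂ αν))
  bitCode-ok (α , ν) (α≥ , sub , w) = α≥ , sym (length-bitsOf ℓ ν) , +-cancelʳ-≡ (sum ν) _ _ (begin
      2 * sum α + base bs + sum ν
        ≡⟨ cong (λ ν′ → 2 * sum α + base bs + sum ν′) (sym (negParts-bitsOf ℓ ν sub)) ⟩
      2 * sum α + base bs + sum (negParts bs)    ≡⟨ +-assoc (2 * sum α) (base bs) _ ⟩
      2 * sum α + (base bs + sum (negParts bs))  ≡⟨ cong (2 * sum α +_) (base+sum-negParts bs) ⟩
      2 * sum α + length bs * (1 + 2 * length bs) ≡⟨ cong (λ l → 2 * sum α + l * (1 + 2 * l)) (length-bitsOf ℓ ν) ⟩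
      2 * sum α + ℓ * (1 + 2 * ℓ)                ≡⟨ w ⟩
      n + sum ν                                  ∎)
    where
    open ≡-Reasoning
    ℓ : ℕ
    ℓ = length α
    bs : List Bool
    bs = bitsOf ℓ ν
  bits∘neg : ∀ αbs → BitCode n αbs → (proj₁ αbs , bitsOf (length (proj₁ αbs)) (negParts (proj₂ αbs))) ≡ αbs
  bits∘neg (α , bs) (_ , len , _) = cong (α ,_) (trans (cong (λ ℓ → bitsOf ℓ (negParts bs)) len) (bitsOf-negParts bs))
  neg∘bits : ∀ αν → Code n αν → (proj₁ αν , negParts (bitsOf (length (proj₁ αν)) (proj₂ αν))) ≡ αν
  neg∘bits (α , ν) (_ , sub , _) = cong (α ,_) (negParts-bitsOf (length α) ν sub)

lg2↔code : ∀ n → LG2Set n ↔ CodeSet n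
lg2↔code n = ↔-trans (lg2↔bitCode n) (bitCode↔code n)

-- Signed partitions with odd positive parts

-- Staircases of odd parts with floor c ℓ and step d, where ℓ is the number of parts.
module OddStaircase (c : ℕ → ℕ) (d : ℕ)
  (base-replicate : ∀ ℓ → Staircase.base (c ℓ) (λ _ → d) (replicate ℓ true) ≡ ℓ * (1 + 2 * ℓ)) where

  module S (ℓ : ℕ) = Staircase (c ℓ) (λ _ → d)

  IsSigned : ℕ → List ℕ × List ℕ → Set
  IsSigned n (π , ν) = S.Stair (length π) π × All (T ∘ odd) π × OddSubset (length π) ν × sum π ≡ n + sum ν

  odd-replicate : ∀ {π} → All (T ∘ odd) π → map odd π ≡ replicate (length π) true
  odd-replicate [] = refl
  odd-replicate (ox ∷ oπ) = cong₂ _∷_ (to T-≡ ox) (odd-replicate oπ)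

  raise-odd : ∀ ℓ α k → All (T ∘ odd) (S.raise ℓ α (replicate k true))
  raise-odd ℓ [] k = []
  raise-odd ℓ (a ∷ α) zero = []
  raise-odd ℓ (a ∷ α) (suc k) = from T-≡ (odd-bit+2* true (a + S.floor ℓ (replicate k true))) ∷ raise-odd ℓ α k

  raise-lower-odd : ∀ ℓ π → S.Stair ℓ π → All (T ∘ odd) π →
                    S.raise ℓ (S.lower ℓ π) (replicate (length π) true) ≡ π
  raise-lower-odd ℓ π st oπ = subst (λ bs → S.raise ℓ (S.lower ℓ π) bs ≡ π) (odd-replicate oπ) (S.raise-lower ℓ π st)

  lowerOdd : List ℕ → List ℕ
  lowerOdd π = S.lower (length π) π

  raiseOdd : List ℕ → List ℕ
  raiseOdd α = S.raise (length α) α (replicate (length α) true)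

  length-raiseOdd : ∀ α → length (raiseOdd α) ≡ length α
  length-raiseOdd α = S.length-raise (length α) α _ (sym (List.length-replicate (length α)))

  raiseOdd-lowerOdd : ∀ π → S.Stair (length π) π → All (T ∘ odd) π → raiseOdd (lowerOdd π) ≡ π
  raiseOdd-lowerOdd π st oπ = trans
    (cong (λ l → S.raise l (lowerOdd π) (replicate l true)) (S.length-lower (length π) π))
    (raise-lower-odd (length π) π st oπ)

  lowerOdd-raiseOdd : ∀ α → lowerOdd (raiseOdd α) ≡ α
  lowerOdd-raiseOdd α = trans
    (cong (λ l → S.lower l (raiseOdd α)) (length-raiseOdd α))
    (S.lower-raise (length α) α _ (sym (List.length-replicate (length α))))

  lowerOdd-code : ∀ n π ν → IsSigned n (π , ν) → Code n (lowerOdd π , ν)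
  lowerOdd-code n π ν (st , oπ , sub , w) =
    S.lower-nonInc ℓ π st , subst (flip OddSubset ν) (sym (S.length-lower ℓ π)) sub , (begin
      2 * sum α + length α * (1 + 2 * length α) ≡⟨ cong (λ l → 2 * sum α + l * (1 + 2 * l)) (S.length-lower ℓ π) ⟩
      2 * sum α + ℓ * (1 + 2 * ℓ)               ≡⟨ cong (2 * sum α +_) (sym (base-replicate ℓ)) ⟩
      2 * sum α + S.base ℓ (replicate ℓ true)   ≡⟨ sym (S.sum-raise ℓ α _ α-length) ⟩
      sum (S.raise ℓ α (replicate ℓ true))      ≡⟨ cong sum (raise-lower-odd ℓ π st oπ) ⟩
      sum π                                     ≡⟨ w ⟩
      n + sum ν                                 ∎)
    where
    open ≡-Reasoning
    ℓ : ℕ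
    ℓ = length π
    α : List ℕ
    α = lowerOdd π
    α-length : length α ≡ length (replicate ℓ true)
    α-length = trans (S.length-lower ℓ π) (sym (List.length-replicate ℓ))

  raiseOdd-signed : ∀ n α ν → Code n (α , ν) → IsSigned n (raiseOdd α , ν)
  raiseOdd-signed n α ν (α≥ , sub , w) =
    subst (λ l → S.Stair l π × All (T ∘ odd) π × OddSubset l ν × sum π ≡ n + sum ν) (sym (length-raiseOdd α))
      (S.raise-stair ℓ α _ α≥ , raise-odd ℓ α ℓ , sub , (begin
        sum π                                   ≡⟨ S.sum-raise ℓ α _ (sym (List.length-replicate ℓ)) ⟩
        2 * sum α + S.base ℓ (replicate ℓ true) ≡⟨ cong (2 * sum α +_) (base-replicate ℓ) ⟩
        2 * sum α + ℓ * (1 + 2 * ℓ)             ≡⟨ w ⟩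
        n + sum ν                               ∎))
    where
    open ≡-Reasoning
    ℓ : ℕ
    ℓ = length α
    π : List ℕ
    π = raiseOdd α

  signed↔code : ∀ n (cond : List ℕ → List ℕ → Bool) → (∀ π ν → T (cond π ν) ⇔ IsSigned n (π , ν)) →
                (Σ (List ℕ) λ π → Σ (List ℕ) λ ν → T (cond π ν)) ↔ CodeSet n
  signed↔code n cond cond⇔ = ↔-trans (↔-sym Σ-assoc) (ΣT-↔ (uncurry cond⇔) (T-codeCond n)
    (Product.map₁ lowerOdd) (Product.map₁ raiseOdd)
    (λ (π , ν) → lowerOdd-code n π ν) (λ (α , ν) → raiseOdd-signed n α ν)
    (λ (π , ν) (st , oπ , _) → cong (_, ν) (raiseOdd-lowerOdd π st oπ))
    (λ (α , ν) _ → cong (_, ν) (lowerOdd-raiseOdd α)))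

base-flat : ∀ c k → Staircase.base c (λ _ → 0) (replicate k true) ≡ k * (1 + 2 * c)
base-flat c zero = refl
base-flat c (suc k) = cong₂ (λ f B → 1 + 2 * f + B) (floor-flat k) (base-flat c k)
  where
  floor-flat : ∀ k → Staircase.floor c (λ _ → 0) (replicate k true) ≡ c
  floor-flat zero = refl
  floor-flat (suc k) = floor-flat k

module LGm2Staircase = OddStaircase (λ ℓ → ℓ) 0 (λ ℓ → base-flat ℓ ℓ)

lgm2-positive⇔ : ∀ ℓ π → (Partition π × All (λ x → T (odd x) × 2 * ℓ ≤ x) π) ⇔
                          (LGm2Staircase.S.Stair ℓ π × All (T ∘ odd) π)
lgm2-positive⇔ ℓ π = mk⇔
  (λ ((_ , π≥) , pos) →
    (Linked.map ⌊n/2⌋-mono π≥ , All.map (λ {x} (_ , 2ℓ≤x) → to (2ℓ≤⇔ x) 2ℓ≤x) pos) , All.map proj₁ pos)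
  (λ ((gaps , floors) , oπ) →
    (All.map odd⇒1≤ oπ ,
     Linked-map-All (λ {x} {y} ox oy gap → subst (_≤ x) (+-identityʳ y) (from (odd-≤⇔ y 0 x oy ox) gap)) oπ gaps) ,
    All.zipWith (λ {x} (ox , ℓ≤) → ox , from (2ℓ≤⇔ x) ℓ≤) (oπ , floors))
  where
  2ℓ≤⇔ : ∀ x → (2 * ℓ ≤ x) ⇔ (ℓ ≤ ⌊ x /2⌋)
  2ℓ≤⇔ x = subst (λ m → (2 * ℓ ≤ x) ⇔ (m ≤ ⌊ x /2⌋)) (+-identityʳ ℓ) (≤⇔⌊/2⌋ 0 ℓ x)

lgm2Cond⇔ : ∀ n π ν → T (lgm2Cond n π ν) ⇔ LGm2Staircase.IsSigned n (π , ν)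
lgm2Cond⇔ n π ν = ⇔-trans mirror (mk⇔
  (λ ((πp , νp , w) , pos , neg , ν≢) → let st , oπ = to (lgm2-positive⇔ ℓ π) (πp , pos) in
    st , oπ , to (oddSubset⇔ {ℓ} {ν}) (νp , neg , ν≢) , w)
  (λ (st , oπ , sub , w) →
    let πp , pos = from (lgm2-positive⇔ ℓ π) (st , oπ)
        νp , neg , ν≢ = from (oddSubset⇔ {ℓ} {ν}) sub
    in
    (πp , νp , w) , pos , neg , ν≢))
  where
  ℓ : ℕ
  ℓ = length π
  mirror : T (lgm2Cond n π ν) ⇔
           ((Partition π × Partition ν × sum π ≡ n + sum ν) × All (λ x → T (odd x) × 2 * ℓ ≤ x) π ×
            All (λ y → T (odd y) × y < 2 * ℓ) ν × AllPairs _≢_ ν)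
  mirror = (T-isPartition ∧-⇔ T-isPartition ∧-⇔ T-≡ᵇ) ∧-⇔ T-allB (⇔-id _ ∧-⇔ T-≤ᵇ) ∧-⇔
           T-allB (λ {y} → T-odd∧≤ᵇ2* {ℓ} {y}) ∧-⇔
           T-pairwiseB T-≢ᵇ

base-staircase : ∀ k → Staircase.base 1 (λ _ → 2) (replicate k true) ≡ k * (1 + 2 * k)
base-staircase zero = refl
base-staircase (suc k) = begin
  1 + 2 * floor (replicate k true) + base (replicate k true)
    ≡⟨ cong₂ (λ f B → 1 + 2 * f + B) (floor-staircase k) (base-staircase k) ⟩
  1 + 2 * (1 + 2 * k) + k * (1 + 2 * k)                     ≡⟨ *-1+2*-suc k ⟩
  suc k * (1 + 2 * suc k)                                   ∎
  where
  open ≡-Reasoning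
  open Staircase 1 (λ _ → 2) using (floor; base)
  2+[1+2*k] : ∀ k → 2 + (1 + 2 * k) ≡ 1 + 2 * suc k
  2+[1+2*k] = solve-∀
  floor-staircase : ∀ k → floor (replicate k true) ≡ 1 + 2 * k
  floor-staircase zero = refl
  floor-staircase (suc k) = trans (cong (2 +_) (floor-staircase k)) (2+[1+2*k] k)

module LGm2′Staircase = OddStaircase (λ _ → 1) 2 base-staircase

Apart : ℕ → ℕ → Set
Apart x y = y + 4 ≤ x ⊎ x + 4 ≤ y

lgm2′-positive⇔ : ∀ ℓ π → (Partition π × All (λ x → T (odd x) × 3 ≤ x) π × AllPairs Apart π) ⇔
                           (LGm2′Staircase.S.Stair ℓ π × All (T ∘ odd) π)
lgm2′-positive⇔ ℓ π = mk⇔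
  (λ ((_ , π≥) , pos , apart) →
    let oπ = All.map proj₁ pos in
    (Linked-map-All (λ {x} {y} ox oy → to (odd-≤⇔ y 2 x oy ox)) oπ
                    (Linked.zipWith descending-apart (π≥ , AllPairs⇒Linked apart)) ,
     All.map (λ {x} (ox , 3≤x) → to (odd-≤⇔ 1 1 x tt ox) 3≤x) pos) , oπ)
  (λ ((gaps , floors) , oπ) →
    let π-4 = Linked-map-All (λ {x} {y} ox oy → from (odd-≤⇔ y 2 x oy ox)) oπ gaps in
    (All.map odd⇒1≤ oπ , Linked.map (λ {x} {y} y+4≤x → ≤-trans (m≤m+n y 4) y+4≤x) π-4) ,
    All.zipWith (λ {x} (ox , 1≤) → ox , from (odd-≤⇔ 1 1 x tt ox) 1≤) (oπ , floors) ,
    AllPairs.map inj₁ (Linked⇒AllPairs (λ {x} {y} y+4≤x z+4≤y → ≤-trans z+4≤y (≤-trans (m≤m+n y 4) y+4≤x)) π-4))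
  where
  descending-apart : ∀ {x y} → y ≤ x × Apart x y → y + 4 ≤ x
  descending-apart (_ , inj₁ y+4≤x) = y+4≤x
  descending-apart {x} (y≤x , inj₂ x+4≤y) = ⊥-elim (m+1+n≰m x (≤-trans x+4≤y y≤x))

lgm2′Cond⇔ : ∀ n π ν → T (lgm2'Cond n π ν) ⇔ LGm2′Staircase.IsSigned n (π , ν)
lgm2′Cond⇔ n π ν = ⇔-trans mirror (mk⇔
  (λ ((πp , νp , w) , pos , apart , neg , ν≢) →
    let st , oπ = to (lgm2′-positive⇔ ℓ π) (πp , pos , apart) in
    st , oπ , to (oddSubset⇔ {ℓ} {ν}) (νp , neg , ν≢) , w)
  (λ (st , oπ , sub , w) →
    let πp , pos , apart = from (lgm2′-positive⇔ ℓ π) (st , oπ)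
        νp , neg , ν≢ = from (oddSubset⇔ {ℓ} {ν}) sub
    in
    (πp , νp , w) , pos , apart , neg , ν≢))
  where
  ℓ : ℕ
  ℓ = length π
  mirror : T (lgm2'Cond n π ν) ⇔
           ((Partition π × Partition ν × sum π ≡ n + sum ν) × All (λ x → T (odd x) × 3 ≤ x) π × AllPairs Apart π ×
            All (λ y → T (odd y) × y < 2 * ℓ) ν × AllPairs _≢_ ν)
  mirror = (T-isPartition ∧-⇔ T-isPartition ∧-⇔ T-≡ᵇ) ∧-⇔ T-allB (⇔-id _ ∧-⇔ T-≤ᵇ) ∧-⇔
           T-pairwiseB (T-≤ᵇ ∨-⇔ T-≤ᵇ) ∧-⇔
           T-allB (λ {y} → T-odd∧+1≤ᵇ2* {ℓ} {y}) ∧-⇔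
           T-pairwiseB T-≢ᵇ

lg2-finite : ∀ n → ∃ λ k → LG2Set n ↔ Fin k
lg2-finite n =
  ΣT-finite (List.≡-dec _≟_) (lg2Cond n) (boundedLists n n) (partition∈boundedLists ∘ proj₁ ∘ to T-∧)

theorem5p5 : (n : ℕ) →
    Σ ℕ λ k → (LG2Set n ↔ Fin k) × (LGm2Set n ↔ Fin k) × (LGm2'Set n ↔ Fin k)
theorem5p5 n =
  let k , lg2↔Fin = lg2-finite n
      code↔Fin = ↔-trans (↔-sym (lg2↔code n)) lg2↔Fin
  in k , lg2↔Fin ,
     ↔-trans (LGm2Staircase.signed↔code n (lgm2Cond n) (lgm2Cond⇔ n)) code↔Fin ,
     ↔-trans (LGm2′Staircase.signed↔code n (lgm2'Cond n) (lgm2′Cond⇔ n)) code↔Fin
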